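{- Let $\mathcal{H}=(V,E)$ be a connected $k$-uniform hypergraph with at least one edge such that for every edge $h\in E$, the hypergraph $(V,E\setminus\{h\})$ is not connected. Then there is an edge $h\in E$ such that the hypergraph $(V,E\setminus\{h\})$ has at most one connected component containing more than one vertex.
   Context: A $k$-uniform hypergraph is a pair $(V,E)$ with $E\subseteq\binom{V}{k}$. Two vertices are in the same connected component if they are joined by a Berge path, i.e. a sequence of distinct vertices and distinct edges $v_0h_1v_1\dots h_dv_d$ with $v_{i-1},v_i\in h_i$ for each $i$; the hypergraph is connected if it has exactly one component. -}

module Defs where

open import Data.Nat using (ℕ; suc)
open import Data.Fin using (Fin; inject₁; fromℕ) renaming (suc to fsuc)
open import Data.Fin.Subset using (Subset; ∣_∣) renaming (_∈_ to _∈ₛ_)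
open import Data.List using (List; length; removeAt)
open import Data.List.Membership.Propositional using (_∈_)
open import Data.List.Relation.Unary.All using (All)
open import Data.List.Relation.Unary.Unique.Propositional using (Unique)
open import Data.Product using (Σ; ∃; _×_)
open import Function.Definitions using (Injective)
open import Relation.Binary.PropositionalEquality using (_≡_; _≢_)

record Hypergraph (n k : ℕ) : Set where
  constructor mkHypergraph
  field
    edges   : List (Subset n)
    unique  : Unique edges
    uniform : All (λ h → ∣ h ∣ ≡ k) edges

open Hypergraph public

record BergePath {n : ℕ} (E : List (Subset n)) (u v : Fin n) : Set where
  field
    len        : ℕ
    verts      : Fin (suc len) → Fin n
    hedges     : Fin len → Subset n
    start      : verts Data.Fin.zero ≡ u
    end        : verts (fromℕ len) ≡ v
    vertsDist  : Injective _≡_ _≡_ verts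
    edgesDist  : Injective _≡_ _≡_ hedges
    edgesIn    : ∀ i → hedges i ∈ E
    leftIn     : ∀ i → verts (inject₁ i) ∈ₛ hedges i
    rightIn    : ∀ i → verts (fsuc i) ∈ₛ hedges i

Joined : {n : ℕ} → List (Subset n) → Fin n → Fin n → Set
Joined E u v = BergePath E u v

-- Exactly one connected component: V is nonempty and any two vertices are joined.
Connected : {n : ℕ} → List (Subset n) → Set
Connected {n} E = Fin n × (∀ u v → Joined E u v)

-- At most one connected component contains more than one vertex:
-- any two components each containing two distinct vertices coincide.
AtMostOneNontrivialComponent : {n : ℕ} → List (Subset n) → Set
AtMostOneNontrivialComponent {n} E =
  ∀ (u v u′ v′ : Fin n) → u ≢ v → Joined E u v → u′ ≢ v′ → Joined E u′ v′ → Joined E u u′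

-- The edge list E \ {h}, where h is the i-th edge (edges are distinct).
deleteEdge : {n : ℕ} (E : List (Subset n)) → Fin (length E) → List (Subset n)
deleteEdge E i = removeAt E i

{-# OPTIONS --safe #-}
module Submission where

-- Pick an edge h and a vertex x such that the component of x in E ∖ h is as large as possible.
-- Then every component of E ∖ h with at least two vertices contains x. Otherwise some u not
-- joined to x lies in an edge g of E ∖ h; the component of x misses g, so it survives in E ∖ g,
-- and there it grows, since a walk in E from x to u leaves it through h, which E ∖ g contains.
-- Berge paths are replaced by walks: a walk shortens to a Berge path, which has at most as many
-- edges as there are vertices, and this bound makes joinedness decidable.

open import Defs
open import Data.Bool.Properties using () renaming (_≟_ to _≟ᵇ_)
open import Data.Fin using (Fin; zero; inject₁; fromℕ; fromℕ<) renaming (suc to fsuc)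
import Data.Fin.Properties as Fin
open import Data.Fin.Properties using (any?; pigeonhole)
open import Data.Fin.Subset using (Subset; ∣_∣) renaming (_∈_ to _∈ₛ_)
open import Data.Fin.Subset.Properties using (p⊂q⇒∣p∣<∣q∣) renaming (_∈?_ to _∈ₛ?_)
open import Data.List using (List; []; _∷_; length; removeAt; lookup)
open import Data.List.Extrema.Nat using (argmax; f[xs]≤f[argmax])
open import Data.List.Membership.Propositional using (_∈_; _∉_; find; lose)
open import Data.List.Membership.Propositional.Properties using (∈-lookup; ∈-allFin; ∈-cartesianProduct⁺)
import Data.List.Membership.DecPropositional as DecMembership
open import Data.List.Relation.Binary.Subset.Propositional using () renaming (_⊆_ to _⊆ᴸ_)
import Data.List.Relation.Unary.All as All
open import Data.List.Relation.Unary.AllPairs using (_∷_)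
open import Data.List.Relation.Unary.Any using (here; there; index) renaming (any? to anyᴸ?)
open import Data.List.Relation.Unary.Any.Properties using (lookup-index)
open import Data.List.Relation.Unary.Unique.Propositional using (Unique)
open import Data.Nat using (ℕ; zero; suc; _≤_; _<_; _≥_; s≤s)
open import Data.Nat.Properties using (≮⇒≥; m<n⇒m<1+n; <⇒≱)
open import Data.Product using (Σ; ∃; ∃₂; _×_; _,_; -,_; proj₁; proj₂)
open import Data.Sum using (_⊎_; inj₁; inj₂)
open import Data.Vec using (tabulate)
open import Data.Vec.Functional using (Vector) renaming (_∷_ to _◂_)
open import Data.Vec.Properties using (≡-dec; lookup⇒[]=; []=⇒lookup; lookup∘tabulate)
open import Function using (_∘_)
open import Function.Definitions using (Injective)
open import Level using (Level)
open import Relation.Binary using (Rel)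
open import Relation.Binary.Construct.Closure.ReflexiveTransitive using (Star; ε; _◅_; _◅◅_; reverse)
open import Relation.Binary.PropositionalEquality using (_≡_; _≢_; refl; sym; trans; subst; subst₂; cong)
open import Relation.Nullary using (¬_; Dec; yes; no; does; contradiction)
open import Relation.Nullary.Decidable using (_×-dec_; map′; dec-true)
open import Relation.Unary using (Pred; Decidable)

private
  variable
    a ℓ ℓ′ : Level
    A : Set a
    n : ℕ

module _ {R : Rel A ℓ} {S : Rel A ℓ′} where

  Star-map-reachable : ∀ {x y} → (∀ {a b} → Star R x a → R a b → S a b) → Star R x y → Star S x y
  Star-map-reachable f ε        = ε
  Star-map-reachable f (r ◅ rs) = f ε r ◅ Star-map-reachable (f ∘ (r ◅_)) rs

module _ {R : Rel A ℓ} {P : Pred A ℓ′} (P? : Decidable P) where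

  Star-boundary-step : ∀ {x y} → Star R x y → P x → ¬ P y → ∃₂ λ a b → R a b × P a × ¬ P b
  Star-boundary-step ε                   px ¬py = contradiction px ¬py
  Star-boundary-step (_◅_ {j = z} r rs) px ¬py with P? z
  ... | yes pz = Star-boundary-step rs pz ¬py
  ... | no ¬pz = -, -, r , px , ¬pz

module _ {m : ℕ} {x : A} {xs : Vector A m} where

  ◂-injective : Injective _≡_ _≡_ xs → (∀ i → xs i ≢ x) → Injective _≡_ _≡_ (x ◂ xs)
  ◂-injective inj x∉xs {zero}   {zero}   _  = refl
  ◂-injective inj x∉xs {zero}   {fsuc j} eq = contradiction (sym eq) (x∉xs j)
  ◂-injective inj x∉xs {fsuc i} {zero}   eq = contradiction eq (x∉xs i)
  ◂-injective inj x∉xs {fsuc i} {fsuc j} eq = cong fsuc (inj eq)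

∈-removeAt⁻ : ∀ {x} (xs : List A) i → x ∈ removeAt xs i → x ∈ xs
∈-removeAt⁻ (y ∷ xs) zero     x∈           = there x∈
∈-removeAt⁻ (y ∷ xs) (fsuc i) (here refl)  = here refl
∈-removeAt⁻ (y ∷ xs) (fsuc i) (there x∈)   = there (∈-removeAt⁻ xs i x∈)

∈-removeAt⁺ : ∀ {x} (xs : List A) i → x ∈ xs → x ≡ lookup xs i ⊎ x ∈ removeAt xs i
∈-removeAt⁺ (y ∷ xs) zero     (here eq)  = inj₁ eq
∈-removeAt⁺ (y ∷ xs) zero     (there x∈) = inj₂ x∈
∈-removeAt⁺ (y ∷ xs) (fsuc i) (here eq)  = inj₂ (here eq)
∈-removeAt⁺ (y ∷ xs) (fsuc i) (there x∈) with ∈-removeAt⁺ xs i x∈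
... | inj₁ eq  = inj₁ eq
... | inj₂ x∈′ = inj₂ (there x∈′)

lookup∉removeAt : ∀ {xs : List A} → Unique xs → ∀ i → lookup xs i ∉ removeAt xs i
lookup∉removeAt (x≢xs ∷ _)  zero     x∈xs        = All.lookup x≢xs x∈xs refl
lookup∉removeAt (x≢xs ∷ _)  (fsuc i) (here eq)   = All.lookup x≢xs (∈-lookup i) (sym eq)
lookup∉removeAt (_ ∷ uniq)  (fsuc i) (there x∈)  = lookup∉removeAt uniq i x∈

lookup∈removeAt-swap : ∀ {xs : List A} → Unique xs → ∀ {i j} →
                       lookup xs j ∈ removeAt xs i → lookup xs i ∈ removeAt xs j
lookup∈removeAt-swap {xs = xs} uniq {i} {j} xⱼ∈ with ∈-removeAt⁺ xs j (∈-lookup i)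
... | inj₁ xᵢ≡xⱼ = contradiction (subst (_∈ removeAt xs i) (sym xᵢ≡xⱼ) xⱼ∈) (lookup∉removeAt uniq i)
... | inj₂ xᵢ∈   = xᵢ∈

module _ {P : Pred (Fin n) ℓ} (P? : Decidable P) where

  toSubset : Subset n
  toSubset = tabulate (does ∘ P?)

  ∈-toSubset⁺ : ∀ {x} → P x → x ∈ₛ toSubset
  ∈-toSubset⁺ {x} px =
    lookup⇒[]= x toSubset (trans (lookup∘tabulate (does ∘ P?) x) (dec-true (P? x) px))

  ∈-toSubset⁻ : ∀ {x} → x ∈ₛ toSubset → P x
  ∈-toSubset⁻ {x} x∈ with P? x | trans (sym (lookup∘tabulate (does ∘ P?) x)) ([]=⇒lookup x∈)
  ... | yes px | _  = px
  ... | no  _  | ()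

module _ {P : Pred (Fin n) ℓ} {Q : Pred (Fin n) ℓ′} (P? : Decidable P) (Q? : Decidable Q) where

  ∣toSubset∣-strict-mono : (∀ {x} → P x → Q x) → ∀ {y} → Q y → ¬ P y →
                           ∣ toSubset P? ∣ < ∣ toSubset Q? ∣
  ∣toSubset∣-strict-mono P⊆Q {y} qy ¬py = p⊂q⇒∣p∣<∣q∣
    ( ∈-toSubset⁺ Q? ∘ P⊆Q ∘ ∈-toSubset⁻ P?
    , y , ∈-toSubset⁺ Q? qy , ¬py ∘ ∈-toSubset⁻ P? )

maximiser : (f : A → ℕ) {xs : List A} → (∀ a → a ∈ xs) → A → ∃ λ a → ∀ b → f b ≤ f a
maximiser f {xs} complete a₀ =
  argmax f a₀ xs , λ b → All.lookup (f[xs]≤f[argmax] a₀ xs) (complete b)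

module _ {n : ℕ} where

  Adj : List (Subset n) → Rel (Fin n) _
  Adj E a b = Σ (Subset n) λ h → h ∈ E × a ∈ₛ h × b ∈ₛ h

  Walk : List (Subset n) → Rel (Fin n) _
  Walk E = Star (Adj E)

  Adj-sym : ∀ {E a b} → Adj E a b → Adj E b a
  Adj-sym (h , h∈E , a∈h , b∈h) = h , h∈E , b∈h , a∈h

  Walk-reverse : ∀ {E a b} → Walk E a b → Walk E b a
  Walk-reverse = reverse Adj-sym

  adj? : ∀ E a b → Dec (Adj E a b)
  adj? E a b = map′ find (λ (h , h∈E , a∈h , b∈h) → lose h∈E (a∈h , b∈h))
                     (anyᴸ? (λ h → a ∈ₛ? h ×-dec b ∈ₛ? h) E)

  data BoundedWalk (E : List (Subset n)) : ℕ → Fin n → Fin n → Set where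
    stay : ∀ {k x} → BoundedWalk E k x x
    step : ∀ {k x y z} → Adj E x y → BoundedWalk E k y z → BoundedWalk E (suc k) x z

  boundedWalk? : ∀ E k x y → Dec (BoundedWalk E k x y)
  boundedWalk? E k x y with x Fin.≟ y
  boundedWalk? E k       x .x | yes refl = yes stay
  boundedWalk? E zero    x y  | no x≢y   = no λ { stay → x≢y refl }
  boundedWalk? E (suc k) x y  | no x≢y   =
    map′ (λ (z , a , w) → step a w)
         (λ { stay → contradiction refl x≢y ; (step a w) → -, a , w })
         (any? λ z → adj? E x z ×-dec boundedWalk? E k z y)

  BoundedWalk⇒Walk : ∀ {E k x y} → BoundedWalk E k x y → Walk E x y
  BoundedWalk⇒Walk stay       = ε
  BoundedWalk⇒Walk (step a w) = a ◅ BoundedWalk⇒Walk w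

  BoundedWalk-mono : ∀ {E k l x y} → k ≤ l → BoundedWalk E k x y → BoundedWalk E l x y
  BoundedWalk-mono _         stay       = stay
  BoundedWalk-mono (s≤s k≤l) (step a w) = step a (BoundedWalk-mono k≤l w)

module _ {n : ℕ} {E : List (Subset n)} where

  chain⇒BoundedWalk : ∀ L (vs : Fin (suc L) → Fin n) → (∀ i → Adj E (vs (inject₁ i)) (vs (fsuc i))) →
                      BoundedWalk E L (vs zero) (vs (fromℕ L))
  chain⇒BoundedWalk zero    vs adj = stay
  chain⇒BoundedWalk (suc L) vs adj = step (adj zero) (chain⇒BoundedWalk L (vs ∘ fsuc) (adj ∘ fsuc))

  module _ {u v : Fin n} (P : BergePath E u v) where
    open BergePath P

    BergePath⇒BoundedWalk : BoundedWalk E len u v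
    BergePath⇒BoundedWalk = subst₂ (BoundedWalk E len) start end
      (chain⇒BoundedWalk len verts λ i → hedges i , edgesIn i , leftIn i , rightIn i)

    BergePath-len≤n : len ≤ n
    BergePath-len≤n = ≮⇒≥ λ n<len →
      let i , j , i<j , vᵢ≡vⱼ = pigeonhole (m<n⇒m<1+n n<len) verts
      in  Fin.<-irrefl (vertsDist vᵢ≡vⱼ) i<j

  BergePath⇒Walk : ∀ {u v} → BergePath E u v → Walk E u v
  BergePath⇒Walk = BoundedWalk⇒Walk ∘ BergePath⇒BoundedWalk

  BergePath-trivial : ∀ v → BergePath E v v
  BergePath-trivial v = record
    { len = 0 ; verts = λ _ → v ; hedges = λ () ; start = refl ; end = refl
    ; vertsDist = λ { {zero} {zero} _ → refl } ; edgesDist = λ { {()} }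
    ; edgesIn = λ () ; leftIn = λ () ; rightIn = λ () }

  BergePath-cons : ∀ {h u w v} → h ∈ E → u ∈ₛ h → w ∈ₛ h → (P : BergePath E w v) →
                   (∀ i → BergePath.verts P i ≢ u) → (∀ i → BergePath.hedges P i ≢ h) → BergePath E u v
  BergePath-cons {h} {u} h∈E u∈h w∈h P u∉P h∉P = record
    { len = suc len ; verts = u ◂ verts ; hedges = h ◂ hedges ; start = refl ; end = end
    ; vertsDist = ◂-injective vertsDist u∉P ; edgesDist = ◂-injective edgesDist h∉P
    ; edgesIn = λ { zero → h∈E ; (fsuc i) → edgesIn i }
    ; leftIn  = λ { zero → u∈h ; (fsuc i) → leftIn i }
    ; rightIn = λ { zero → subst (_∈ₛ h) (sym start) w∈h ; (fsuc i) → rightIn i } }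
    where open BergePath P

module _ {n : ℕ} (E : List (Subset n)) where
  open DecMembership (Fin._≟_ {n}) using () renaming (_∈?_ to _∈ⱽ?_)
  open DecMembership (≡-dec {n = n} _≟ᵇ_) using () renaming (_∈?_ to _∈ᴱ?_)

  data SimplePath : Fin n → Fin n → List (Fin n) → List (Subset n) → Set where
    [_]  : ∀ v → SimplePath v v (v ∷ []) []
    cons : ∀ {u w v vs es} h → h ∈ E → u ∈ₛ h → w ∈ₛ h → u ∉ vs → h ∉ es →
           SimplePath w v vs es → SimplePath u v (u ∷ vs) (h ∷ es)

  SomeSimplePath : Fin n → Fin n → Set
  SomeSimplePath u v = ∃₂ (SimplePath u v)

  suffix-from-vertex : ∀ {w v x vs es} → SimplePath w v vs es → x ∈ vs → SomeSimplePath x v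
  suffix-from-vertex p@([ _ ])             (here refl) = -, -, p
  suffix-from-vertex p@(cons _ _ _ _ _ _ _) (here refl) = -, -, p
  suffix-from-vertex (cons _ _ _ _ _ _ p)  (there x∈)  = suffix-from-vertex p x∈

  suffix-after-edge : ∀ {w v h vs es} → SimplePath w v vs es → h ∈ es →
                      ∃ λ y → y ∈ₛ h × Σ (List (Fin n)) λ vs′ → ∃ λ es′ →
                        SimplePath y v vs′ es′ × vs′ ⊆ᴸ vs × h ∉ es′
  suffix-after-edge (cons _ _ _ w∈h _ h∉es p) (here refl) = -, w∈h , -, -, p , there , h∉es
  suffix-after-edge (cons _ _ _ _ _ _ p)      (there h∈)  =
    let y , y∈h , vs′ , es′ , p′ , vs′⊆ , h∉es′ = suffix-after-edge p h∈
    in  y , y∈h , vs′ , es′ , p′ , there ∘ vs′⊆ , h∉es′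

  -- If u or h already occurs on p, cut p back to that occurrence instead of prepending h.
  prepend : ∀ {h u w v vs es} → h ∈ E → u ∈ₛ h → w ∈ₛ h → SimplePath w v vs es → SomeSimplePath u v
  prepend {h} {u} {vs = vs} {es} h∈E u∈h w∈h p with u ∈ⱽ? vs | h ∈ᴱ? es
  ... | yes u∈vs | _      = suffix-from-vertex p u∈vs
  ... | no u∉vs  | no h∉es = -, -, cons h h∈E u∈h w∈h u∉vs h∉es p
  ... | no u∉vs  | yes h∈es =
    let y , y∈h , _ , _ , p′ , vs′⊆vs , h∉es′ = suffix-after-edge p h∈es
    in  -, -, cons h h∈E u∈h y∈h (u∉vs ∘ vs′⊆vs) h∉es′ p′

  Walk⇒SimplePath : ∀ {u v} → Walk E u v → SomeSimplePath u v
  Walk⇒SimplePath {u} ε                           = -, -, [ u ]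
  Walk⇒SimplePath ((h , h∈E , u∈h , w∈h) ◅ walk) =
    let _ , _ , p = Walk⇒SimplePath walk in prepend h∈E u∈h w∈h p

  SimplePath⇒BergePath : ∀ {u v vs es} → SimplePath u v vs es →
    Σ (BergePath E u v) λ P → (∀ i → BergePath.verts P i ∈ vs) × (∀ i → BergePath.hedges P i ∈ es)
  SimplePath⇒BergePath [ v ] = BergePath-trivial v , (λ _ → here refl) , λ ()
  SimplePath⇒BergePath (cons h h∈E u∈h w∈h u∉vs h∉es p) =
    let P , verts∈vs , hedges∈es = SimplePath⇒BergePath p
    in  BergePath-cons h∈E u∈h w∈h P (λ i eq → u∉vs (subst (_∈ _) eq (verts∈vs i)))
                                     (λ i eq → h∉es (subst (_∈ _) eq (hedges∈es i)))
      , (λ { zero → here refl ; (fsuc i) → there (verts∈vs i) })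
      , (λ { zero → here refl ; (fsuc i) → there (hedges∈es i) })

  Walk⇒BergePath : ∀ {u v} → Walk E u v → BergePath E u v
  Walk⇒BergePath walk = let _ , _ , p = Walk⇒SimplePath walk in proj₁ (SimplePath⇒BergePath p)

  walk? : ∀ u v → Dec (Walk E u v)
  walk? u v = map′ BoundedWalk⇒Walk
    (λ walk → let P = Walk⇒BergePath walk
              in  BoundedWalk-mono (BergePath-len≤n P) (BergePath⇒BoundedWalk P))
    (boundedWalk? E n u v)

_∖_ : (F : List (Subset n)) → Fin (length F) → List (Subset n)
F ∖ i = deleteEdge F i

component : List (Subset n) → Fin n → Subset n
component F x = toSubset (walk? F x)

module MaximalComponent {n : ℕ} (E : List (Subset n)) (E-unique : Unique E)
                        (E-connected : ∀ u v → Walk E u v) where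

  size : Fin (length E) × Fin n → ℕ
  size (i , x) = ∣ component (E ∖ i) x ∣

  component-grows : ∀ {i j x u} → u ∈ₛ lookup E j → lookup E j ∈ E ∖ i → ¬ Walk (E ∖ i) x u →
                    size (i , x) < size (j , x)
  component-grows {i} {j} {x} {u} u∈g g∈E∖i x↛u
    with Star-boundary-step (walk? (E ∖ i) x) (E-connected x u) ε x↛u
  ... | a , b , (h , h∈E , a∈h , b∈h) , x→a , x↛b with ∈-removeAt⁺ E i h∈E
  ...   | inj₂ h∈E∖i = contradiction (x→a ◅◅ (h , h∈E∖i , a∈h , b∈h) ◅ ε) x↛b
  ...   | inj₁ refl  = ∣toSubset∣-strict-mono (walk? (E ∖ i) x) (walk? (E ∖ j) x) survives x→b x↛b
    where
      kept : ∀ {a g} → Walk (E ∖ i) x a → g ∈ E ∖ i → a ∈ₛ g → g ∈ E ∖ j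
      kept {g = g} x→a g∈E∖i a∈g with ∈-removeAt⁺ E j (∈-removeAt⁻ E i g∈E∖i)
      ... | inj₁ refl   = contradiction (x→a ◅◅ (g , g∈E∖i , a∈g , u∈g) ◅ ε) x↛u
      ... | inj₂ g∈E∖j = g∈E∖j

      survives : ∀ {y} → Walk (E ∖ i) x y → Walk (E ∖ j) x y
      survives = Star-map-reachable λ x→a (g , g∈ , a∈g , b∈g) → g , kept x→a g∈ a∈g , a∈g , b∈g

      x→b : Walk (E ∖ j) x b
      x→b = survives x→a ◅◅ (h , lookup∈removeAt-swap E-unique g∈E∖i , a∈h , b∈h) ◅ ε

  nontrivial-reaches-maximiser : ∀ {i x} → (∀ p → size p ≤ size (i , x)) →
                                 ∀ {u v} → u ≢ v → Walk (E ∖ i) u v → Walk (E ∖ i) u x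
  nontrivial-reaches-maximiser         maximal u≢v ε = contradiction refl u≢v
  nontrivial-reaches-maximiser {i} {x} maximal {u} u≢v ((g , g∈E∖i , u∈g , _) ◅ _)
    with walk? (E ∖ i) x u
  ... | yes x→u = Walk-reverse x→u
  ... | no  x↛u = contradiction (maximal (j , x)) (<⇒≱ (component-grows u∈lookup lookup∈ x↛u))
    where
      g∈E : g ∈ E
      g∈E = ∈-removeAt⁻ E i g∈E∖i
      j : Fin (length E)
      j = index g∈E
      u∈lookup : u ∈ₛ lookup E j
      u∈lookup = subst (u ∈ₛ_) (lookup-index g∈E) u∈g
      lookup∈ : lookup E j ∈ E ∖ i
      lookup∈ = subst (_∈ E ∖ i) (lookup-index g∈E) g∈E∖i

lemma3 : (n k : ℕ) (H : Hypergraph n k)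
    → Connected (edges H)
    → length (edges H) ≥ 1
    → (∀ (i : Fin (length (edges H))) → ¬ Connected (deleteEdge (edges H) i))
    → ∃ λ (i : Fin (length (edges H))) → AtMostOneNontrivialComponent (deleteEdge (edges H) i)
lemma3 n k H (x₀ , connected) 1≤|E| _ = i , λ u v u′ v′ u≢v u~v u′≢v′ u′~v′ →
  Walk⇒BergePath (E ∖ i) (reaches-x u≢v u~v ◅◅ Walk-reverse (reaches-x u′≢v′ u′~v′))
  where
    E : List (Subset n)
    E = edges H
    open MaximalComponent E (unique H) (λ u v → BergePath⇒Walk (connected u v))

    best : ∃ λ ix → ∀ jy → size jy ≤ size ix
    best = maximiser size (λ (j , y) → ∈-cartesianProduct⁺ (∈-allFin j) (∈-allFin y))
                          (fromℕ< 1≤|E| , x₀)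

    i : Fin (length E)
    i = proj₁ (proj₁ best)
    x : Fin n
    x = proj₂ (proj₁ best)

    reaches-x : ∀ {u v} → u ≢ v → Joined (E ∖ i) u v → Walk (E ∖ i) u x
    reaches-x u≢v u~v = nontrivial-reaches-maximiser (proj₂ best) u≢v (BergePath⇒Walk u~v)
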